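{- If $n$ is a non-negative integer and $r$, $s$ and $t$ are any integers, then, with all sums over $k$ from $0$ to $\lfloor n/2\rfloor$, \[ 10\sum_{k} \binom n{2k}F_{2k + r} F_{2k + s} F_{2k + t} = 2^n \big( F_{2n + s + r + t} + ( - 1)^n F_{n + s + r + t} \bigr) - ( - 1)^r \bigl( F_{2n + s + t - r} - ( - 1)^{s + t - r} F_{n - s - t + r} \bigr) - ( - 1)^t L_{s - t} \bigl( F_{2n + r} - ( - 1)^r F_{n - r} \bigr), \] \[ 10\sum_{k} \binom n{2k}L_{2k + r} F_{2k + s} F_{2k + t} = 2^n \bigl( L_{2n + s + r + t} + ( - 1)^n L_{n + s + r + t} \bigr) + ( - 1)^r \bigl( L_{2n + s + t - r} + ( - 1)^{s + t - r} L_{n - s - t + r} \bigr) - ( - 1)^t L_{s - t} \bigl( L_{2n + r} + ( - 1)^r L_{n - r} \bigr), \] \[ 2\sum_{k} \binom n{2k}L_{2k + r} L_{2k + s} F_{2k + t} = 2^n \bigl( F_{2n + s + r + t} + ( - 1)^n F_{n + s + r + t} \bigr) + ( - 1)^r \bigl( F_{2n + s + t - r} - ( - 1)^{s + t - r} F_{n - s - t + r} \bigr) - ( - 1)^t F_{s - t} \bigl( L_{2n + r} + ( - 1)^r L_{n - r} \bigr), \] \[ 2\sum_{k} \binom n{2k}L_{2k + r} L_{2k + s} L_{2k + t} = 2^n \bigl( L_{2n + s + r + t} + ( - 1)^n L_{n + s + r + t} \bigr) + ( - 1)^r \bigl( L_{2n + s + t - r} + ( - 1)^{s + t - r} L_{n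 - s - t + r} \bigr)+ ( - 1)^t L_{s - t} \bigl( L_{2n + r} + ( - 1)^r L_{n - r} \bigr). \]
   Context: The Fibonacci numbers $F_j$ and Lucas numbers $L_j$ are defined for all integers $j$ by $F_0=0$, $F_1=1$, $L_0=2$, $L_1=1$, $F_j=F_{j-1}+F_{j-2}$, $L_j=L_{j-1}+L_{j-2}$, with $F_{ -j}=(-1)^{j-1}F_j$ and $L_{ -j}=(-1)^jL_j$. -}

module Defs where

open import Data.Nat as ℕ using (ℕ; zero; suc)
open import Data.Nat.Combinatorics using (_C_)
open import Data.Integer using (ℤ; +_; -[1+_]; _+_; _-_; _*_; -_; _^_; ∣_∣)

fibℕ : ℕ → ℕ
fibℕ zero = 0
fibℕ (suc zero) = 1
fibℕ (suc (suc n)) = fibℕ (suc n) ℕ.+ fibℕ n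

lucℕ : ℕ → ℕ
lucℕ zero = 2
lucℕ (suc zero) = 1
lucℕ (suc (suc n)) = lucℕ (suc n) ℕ.+ lucℕ n

neg1^ : ℤ → ℤ
neg1^ j = (- (+ 1)) ^ ∣ j ∣

-- Extension to all integers: F_{-j} = (-1)^{j-1} F_j, L_{-j} = (-1)^j L_j
F : ℤ → ℤ
F (+ n) = + fibℕ n
F -[1+ n ] = (- neg1^ (+ suc n)) * (+ fibℕ (suc n))

L : ℤ → ℤ
L (+ n) = + lucℕ n
L -[1+ n ] = neg1^ (+ suc n) * (+ lucℕ (suc n))

sumTo : ℕ → (ℕ → ℤ) → ℤ
sumTo zero f = f 0
sumTo (suc m) f = sumTo m f + f (suc m)

binSum : ℕ → (ℤ → ℤ) → ℤ
binSum n g = sumTo ℕ.⌊ n /2⌋ (λ k → (+ (n C (2 ℕ.* k))) * g (+ (2 ℕ.* k)))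

-- Call G : ℤ → ℤ a Fibonacci sequence if G (x + 2) = G (x + 1) + G x; two of them that agree at
-- 0 and 1 agree everywhere. This gives the product formulas G x L y = G (x + y) + (-1)^y G (x - y)
-- and (G (x + 1) + G (x - 1)) F y = G (x + y) - (-1)^y G (x - y), and with them each triple product
-- at an even index j becomes a combination of G (3j + c) and G (j + c) for G = F, L. An even
-- binomial sum is half a binomial sum plus half an alternating one, and
-- Σᵢ C(n,i) αⁱ G (p i + c) = βⁿ G (q n + c) as soon as α G (x + p) + G x = β G (x + q); for Fibonacci
-- sequences this holds with (α, β, p, q) = (1, 1, 1, 2), (-1, -1, 1, -1), (1, 2, 3, 2), (-1, -2, 3, 1)
-- (that is, 1 + φ = φ², 1 - φ = -φ⁻¹, 1 + φ³ = 2φ², 1 - φ³ = -2φ), which evaluates every sum.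

module Submission where

open import Defs
open import Data.Nat as ℕ using (ℕ; zero; suc; _<_; _≤_; _≤′_; ≤′-reflexive; ≤′-step; s≤s; z≤n)
import Data.Nat.Properties as ℕₚ
open import Data.Nat.Combinatorics using (_C_; k>n⇒nCk≡0; nCk+nC[k+1]≡[n+1]C[k+1])
open import Data.Integer using (ℤ; +_; -[1+_]; _+_; _-_; _*_; -_; _^_; ∣_∣; 0ℤ; 1ℤ; -1ℤ)
open import Data.Integer.Properties
  using ( +-identityˡ; +-identityʳ; +-assoc; +-comm; *-identityˡ; *-identityʳ; *-assoc; *-comm
        ; *-distribˡ-+; *-distribʳ-+; neg-involutive; neg-distribˡ-*; neg-distribʳ-*; -1*i≡-i
        ; ∣-i∣≡∣i∣; i-j≡0⇒i≡j; i≡j⇒i-j≡0; pos-*; ^-zeroˡ; ^-distribˡ-+-*; ^-*-assoc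
        ; +-commutativeSemigroup; *-commutativeSemigroup )
open import Algebra.Properties.CommutativeSemigroup +-commutativeSemigroup using (interchange)
open import Algebra.Properties.CommutativeSemigroup *-commutativeSemigroup using (x∙yz≈y∙xz)
open import Data.Integer.Tactic.RingSolver using (solve-∀)
open import Data.Product using (_×_; _,_; proj₁)
open import Relation.Binary.PropositionalEquality
  using (_≡_; refl; sym; trans; cong; cong₂; module ≡-Reasoning)
open ≡-Reasoning

-- Signs

ℤ-induction : (P : ℤ → Set) → P 0ℤ → (∀ x → P x → P (+ 1 + x)) → (∀ x → P x → P (-1ℤ + x)) →
              ∀ x → P x
ℤ-induction P base up down (+ zero)     = base
ℤ-induction P base up down (+ suc n)    = up (+ n) (ℤ-induction P base up down (+ n))
ℤ-induction P base up down -[1+ zero ]  = down 0ℤ base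
ℤ-induction P base up down -[1+ suc n ] = down -[1+ n ] (ℤ-induction P base up down -[1+ n ])

neg1^-suc : ∀ x → neg1^ (+ 1 + x) ≡ - neg1^ x
neg1^-suc (+ n)          = -1*i≡-i _
neg1^-suc -[1+ zero ]    = refl
neg1^-suc -[1+ suc n ]   = sym (trans (cong -_ (-1*i≡-i _)) (neg-involutive _))

neg1^-pred : ∀ x → neg1^ (-1ℤ + x) ≡ - neg1^ x
neg1^-pred x = begin
  neg1^ (-1ℤ + x)               ≡⟨ neg-involutive _ ⟨
  - - neg1^ (-1ℤ + x)           ≡⟨ cong -_ (neg1^-suc (-1ℤ + x)) ⟨
  - neg1^ (+ 1 + (-1ℤ + x))     ≡⟨ cong (λ y → - neg1^ y) (trans (sym (+-assoc (+ 1) -1ℤ x)) (+-identityˡ x)) ⟩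
  - neg1^ x                     ∎

neg1^-+ : ∀ x y → neg1^ (x + y) ≡ neg1^ x * neg1^ y
neg1^-+ x = ℤ-induction (λ y → neg1^ (x + y) ≡ neg1^ x * neg1^ y)
  (trans (cong neg1^ (+-identityʳ x)) (sym (*-identityʳ _))) (step (+ 1) neg1^-suc) (step -1ℤ neg1^-pred)
  where
  step : ∀ u → (∀ z → neg1^ (u + z) ≡ - neg1^ z) →
         ∀ y → neg1^ (x + y) ≡ neg1^ x * neg1^ y → neg1^ (x + (u + y)) ≡ neg1^ x * neg1^ (u + y)
  step u flip y ih = begin
    neg1^ (x + (u + y))       ≡⟨ cong neg1^ (swap x u y) ⟩
    neg1^ (u + (x + y))       ≡⟨ flip (x + y) ⟩
    - neg1^ (x + y)           ≡⟨ cong -_ ih ⟩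
    - (neg1^ x * neg1^ y)     ≡⟨ neg-distribʳ-* (neg1^ x) (neg1^ y) ⟩
    neg1^ x * - neg1^ y       ≡⟨ cong (neg1^ x *_) (flip y) ⟨
    neg1^ x * neg1^ (u + y)   ∎
    where swap : ∀ x u y → x + (u + y) ≡ u + (x + y)
          swap = solve-∀

neg1^-neg : ∀ x → neg1^ (- x) ≡ neg1^ x
neg1^-neg x = cong (-1ℤ ^_) (∣-i∣≡∣i∣ x)

neg1^-even : ∀ k → neg1^ (+ (2 ℕ.* k)) ≡ 1ℤ
neg1^-even k = trans (sym (^-*-assoc -1ℤ 2 k)) (^-zeroˡ k)

neg1^-square : ∀ x → neg1^ x * neg1^ x ≡ 1ℤ
neg1^-square x = begin
  -1ℤ ^ k * -1ℤ ^ k      ≡⟨ ^-distribˡ-+-* -1ℤ k k ⟨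
  -1ℤ ^ (k ℕ.+ k)        ≡⟨ cong (λ i → -1ℤ ^ (k ℕ.+ i)) (ℕₚ.+-identityʳ k) ⟨
  -1ℤ ^ (2 ℕ.* k)        ≡⟨ neg1^-even k ⟩
  1ℤ                     ∎
  where k = ∣ x ∣

neg1^-cancel : ∀ x y → neg1^ x * neg1^ (x - y) ≡ neg1^ y
neg1^-cancel x y = begin
  neg1^ x * neg1^ (x - y)              ≡⟨ cong (neg1^ x *_) (neg1^-+ x (- y)) ⟩
  neg1^ x * (neg1^ x * neg1^ (- y))    ≡⟨ *-assoc (neg1^ x) _ _ ⟨
  neg1^ x * neg1^ x * neg1^ (- y)      ≡⟨ cong₂ _*_ (neg1^-square x) (neg1^-neg y) ⟩
  1ℤ * neg1^ y                         ≡⟨ *-identityˡ _ ⟩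
  neg1^ y                              ∎

neg1^-even-shift : ∀ {j} → neg1^ j ≡ 1ℤ → ∀ x → neg1^ (j + x) ≡ neg1^ x
neg1^-even-shift {j} ej x = trans (neg1^-+ j x) (trans (cong (_* neg1^ x) ej) (*-identityˡ _))

-- Fibonacci sequences

-- A record rather than a Π-type, so that G can be inferred from a proof of FibRec G.
record FibRec (G : ℤ → ℤ) : Set where
  constructor fibRec
  field recurrence : ∀ x → G (+ 2 + x) ≡ G (+ 1 + x) + G x

open FibRec

recurrence-at : ∀ {G} → FibRec G → ∀ {x y z} → y ≡ + 1 + x → z ≡ + 2 + x → G z ≡ G y + G x
recurrence-at rG refl refl = recurrence rG _

F-recurrence : ∀ x → F (+ 2 + x) ≡ F (+ 1 + x) + F x
F-recurrence (+ n)                = refl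
F-recurrence -[1+ 0 ]             = refl
F-recurrence -[1+ 1 ]             = refl
F-recurrence -[1+ suc (suc k) ]   = identity (neg1^ (+ k)) (+ fibℕ (suc k)) (+ fibℕ (suc (suc k)))
  where
  identity : ∀ e a b → - (-1ℤ * e) * a ≡ - (-1ℤ * (-1ℤ * e)) * b + - (-1ℤ * (-1ℤ * (-1ℤ * e))) * (b + a)
  identity = solve-∀

L-recurrence : ∀ x → L (+ 2 + x) ≡ L (+ 1 + x) + L x
L-recurrence (+ n)                = refl
L-recurrence -[1+ 0 ]             = refl
L-recurrence -[1+ 1 ]             = refl
L-recurrence -[1+ suc (suc k) ]   = identity (neg1^ (+ k)) (+ lucℕ (suc k)) (+ lucℕ (suc (suc k)))
  where
  identity : ∀ e a b → -1ℤ * e * a ≡ -1ℤ * (-1ℤ * e) * b + -1ℤ * (-1ℤ * (-1ℤ * e)) * (b + a)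
  identity = solve-∀

FibRec-F : FibRec F
FibRec-F = fibRec F-recurrence

FibRec-L : FibRec L
FibRec-L = fibRec L-recurrence

F-neg : ∀ x → F (- x) ≡ - (neg1^ x * F x)
F-neg (+ zero)   = refl
F-neg (+ suc n)  = sym (neg-distribˡ-* (neg1^ (+ suc n)) _)
F-neg -[1+ n ]   = sym (begin
  - (e * (- e * f))   ≡⟨ identity e f ⟩
  e * e * f           ≡⟨ cong (_* f) (neg1^-square (+ suc n)) ⟩
  1ℤ * f              ≡⟨ *-identityˡ f ⟩
  f                   ∎)
  where
  e = neg1^ (+ suc n)
  f = + fibℕ (suc n)
  identity : ∀ e f → - (e * (- e * f)) ≡ e * e * f
  identity = solve-∀

L-neg : ∀ x → L (- x) ≡ neg1^ x * L x
L-neg (+ zero)   = refl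
L-neg (+ suc n)  = refl
L-neg -[1+ n ]   = sym (begin
  e * (e * l)   ≡⟨ *-assoc e e l ⟨
  e * e * l     ≡⟨ cong (_* l) (neg1^-square (+ suc n)) ⟩
  1ℤ * l        ≡⟨ *-identityˡ l ⟩
  l             ∎)
  where
  e = neg1^ (+ suc n)
  l = + lucℕ (suc n)

F-reflect : ∀ x y → neg1^ x * F (y - x) ≡ - (neg1^ y * F (x - y))
F-reflect x y = begin
  neg1^ x * F (y - x)                           ≡⟨ cong (λ z → neg1^ x * F z) (flip x y) ⟩
  neg1^ x * F (- (x - y))                       ≡⟨ cong (neg1^ x *_) (F-neg (x - y)) ⟩
  neg1^ x * - (neg1^ (x - y) * F (x - y))       ≡⟨ pull (neg1^ x) _ _ ⟩
  - (neg1^ x * neg1^ (x - y) * F (x - y))       ≡⟨ cong (λ e → - (e * F (x - y))) (neg1^-cancel x y) ⟩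
  - (neg1^ y * F (x - y))                       ∎
  where
  flip : ∀ x y → y - x ≡ - (x - y)
  flip = solve-∀
  pull : ∀ a b c → a * - (b * c) ≡ - (a * b * c)
  pull = solve-∀

L-reflect : ∀ x y → neg1^ x * L (y - x) ≡ neg1^ y * L (x - y)
L-reflect x y = begin
  neg1^ x * L (y - x)                       ≡⟨ cong (λ z → neg1^ x * L z) (flip x y) ⟩
  neg1^ x * L (- (x - y))                   ≡⟨ cong (neg1^ x *_) (L-neg (x - y)) ⟩
  neg1^ x * (neg1^ (x - y) * L (x - y))     ≡⟨ *-assoc (neg1^ x) _ _ ⟨
  neg1^ x * neg1^ (x - y) * L (x - y)       ≡⟨ cong (_* L (x - y)) (neg1^-cancel x y) ⟩
  neg1^ y * L (x - y)                       ∎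
  where
  flip : ∀ x y → y - x ≡ - (x - y)
  flip = solve-∀

module _ {G H : ℤ → ℤ} (rG : FibRec G) (rH : FibRec H) where

  FibRec-+ : FibRec (λ x → G x + H x)
  FibRec-+ = fibRec λ x →
    trans (cong₂ _+_ (recurrence rG x) (recurrence rH x)) (interchange (G (+ 1 + x)) (G x) (H (+ 1 + x)) (H x))

  FibRec-- : FibRec (λ x → G x - H x)
  FibRec-- = fibRec λ x →
    trans (cong₂ _-_ (recurrence rG x) (recurrence rH x)) (identity (G (+ 1 + x)) (G x) (H (+ 1 + x)) (H x))
    where identity : ∀ a b c d → a + b - (c + d) ≡ a - c + (b - d)
          identity = solve-∀

module _ {G : ℤ → ℤ} (rG : FibRec G) where

  FibRec-*ˡ : ∀ a → FibRec (λ x → a * G x)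
  FibRec-*ˡ a = fibRec λ x → trans (cong (a *_) (recurrence rG x)) (*-distribˡ-+ a _ _)

  FibRec-shiftˡ : ∀ c → FibRec (λ x → G (c + x))
  FibRec-shiftˡ c = fibRec λ x → recurrence-at rG (swap (+ 1) c x) (swap (+ 2) c x)
    where swap : ∀ u c x → c + (u + x) ≡ u + (c + x)
          swap = solve-∀

  FibRec-shiftʳ : ∀ c → FibRec (λ x → G (x + c))
  FibRec-shiftʳ c = fibRec λ x → recurrence-at rG (+-assoc (+ 1) x c) (+-assoc (+ 2) x c)

  FibRec-reflect : ∀ c → FibRec (λ x → neg1^ x * G (c - x))
  FibRec-reflect c = fibRec reflected
    where
    reflected : ∀ x → neg1^ (+ 2 + x) * G (c - (+ 2 + x))
                    ≡ neg1^ (+ 1 + x) * G (c - (+ 1 + x)) + neg1^ x * G (c - x)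
    reflected x = begin
      neg1^ (+ 2 + x) * G y                                     ≡⟨ cong (_* G y) (neg1^-+ (+ 2) x) ⟩
      + 1 * neg1^ x * G y                                       ≡⟨ identity (neg1^ x) (G y) (G (+ 1 + y)) ⟩
      - neg1^ x * G (+ 1 + y) + neg1^ x * (G (+ 1 + y) + G y)
        ≡⟨ cong₂ _+_ (cong₂ _*_ (sym (neg1^-suc x)) (cong G (index₁ c x)))
                     (cong (neg1^ x *_) (sym (recurrence-at rG refl (index₂ c x)))) ⟩
      neg1^ (+ 1 + x) * G (c - (+ 1 + x)) + neg1^ x * G (c - x) ∎
      where
      y = c - (+ 2 + x)
      identity : ∀ e a b → + 1 * e * a ≡ - e * b + e * (b + a)
      identity = solve-∀
      index₁ : ∀ c x → + 1 + (c - (+ 2 + x)) ≡ c - (+ 1 + x)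
      index₁ = solve-∀
      index₂ : ∀ c x → c - x ≡ + 2 + (c - (+ 2 + x))
      index₂ = solve-∀

  recurrence-backward : ∀ x → G (x + + 1) ≡ G x + G (x - + 1)
  recurrence-backward x = recurrence-at rG (index₁ x) (index₂ x)
    where index₁ : ∀ x → x ≡ + 1 + (x - + 1)
          index₁ = solve-∀
          index₂ : ∀ x → x + + 1 ≡ + 2 + (x - + 1)
          index₂ = solve-∀

FibRec-zero : ∀ {D} → FibRec D → D 0ℤ ≡ 0ℤ → D (+ 1) ≡ 0ℤ → ∀ x → D x ≡ 0ℤ
FibRec-zero {D} rD d₀ d₁ x =
  proj₁ (ℤ-induction (λ y → D y ≡ 0ℤ × D (+ 1 + y) ≡ 0ℤ) (d₀ , d₁) up down x)
  where
  up : ∀ y → D y ≡ 0ℤ × D (+ 1 + y) ≡ 0ℤ → D (+ 1 + y) ≡ 0ℤ × D (+ 1 + (+ 1 + y)) ≡ 0ℤ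
  up y (p , q) = q , (begin
    D (+ 1 + (+ 1 + y))    ≡⟨ recurrence-at rD refl (sym (+-assoc (+ 1) (+ 1) y)) ⟩
    D (+ 1 + y) + D y      ≡⟨ cong₂ _+_ q p ⟩
    0ℤ                     ∎)
  down : ∀ y → D y ≡ 0ℤ × D (+ 1 + y) ≡ 0ℤ → D (-1ℤ + y) ≡ 0ℤ × D (+ 1 + (-1ℤ + y)) ≡ 0ℤ
  down y (p , q) = (begin
    D (-1ℤ + y)            ≡⟨ +-identityˡ _ ⟨
    0ℤ + D (-1ℤ + y)       ≡⟨ cong (_+ D (-1ℤ + y)) p ⟨
    D y + D (-1ℤ + y)      ≡⟨ recurrence-at rD (index₁ y) (index₂ y) ⟨
    D (+ 1 + y)            ≡⟨ q ⟩
    0ℤ                     ∎) , trans (cong D (sym (index₁ y))) p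
    where index₁ : ∀ y → y ≡ + 1 + (-1ℤ + y)
          index₁ = solve-∀
          index₂ : ∀ y → + 1 + y ≡ + 2 + (-1ℤ + y)
          index₂ = solve-∀

FibRec-unique : ∀ {G H} → FibRec G → FibRec H → G 0ℤ ≡ H 0ℤ → G (+ 1) ≡ H (+ 1) → ∀ x → G x ≡ H x
FibRec-unique rG rH e₀ e₁ x =
  i-j≡0⇒i≡j _ _ (FibRec-zero (FibRec-- rG rH) (i≡j⇒i-j≡0 e₀) (i≡j⇒i-j≡0 e₁) x)

-- Product formulas

mul-L : ∀ {G} → FibRec G → ∀ x y → G x * L y ≡ G (x + y) + neg1^ y * G (x - y)
mul-L {G} rG x =
  FibRec-unique (FibRec-*ˡ FibRec-L (G x)) (FibRec-+ (FibRec-shiftˡ rG x) (FibRec-reflect rG x)) at₀ at₁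
  where
  at₀ : G x * + 2 ≡ G (x + 0ℤ) + 1ℤ * G (x + 0ℤ)
  at₀ = trans (identity (G x)) (cong (λ z → G z + 1ℤ * G z) (sym (+-identityʳ x)))
    where identity : ∀ g → g * + 2 ≡ g + 1ℤ * g
          identity = solve-∀
  at₁ : G x * + 1 ≡ G (x + + 1) + -1ℤ * G (x - + 1)
  at₁ = trans (identity (G x) (G (x - + 1))) (cong (λ z → z + -1ℤ * G (x - + 1)) (sym (recurrence-backward rG x)))
    where identity : ∀ g h → g * + 1 ≡ g + h + -1ℤ * h
          identity = solve-∀

mul-F : ∀ {G} → FibRec G → ∀ x y → (G (x + + 1) + G (x - + 1)) * F y ≡ G (x + y) - neg1^ y * G (x - y)
mul-F {G} rG x =
  FibRec-unique (FibRec-*ˡ FibRec-F (G (x + + 1) + G (x - + 1))) (FibRec-- (FibRec-shiftˡ rG x) (FibRec-reflect rG x))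
                at₀ at₁
  where
  at₀ : (G (x + + 1) + G (x - + 1)) * 0ℤ ≡ G (x + 0ℤ) - 1ℤ * G (x + 0ℤ)
  at₀ = identity (G (x + + 1) + G (x - + 1)) (G (x + 0ℤ))
    where identity : ∀ a g → a * 0ℤ ≡ g - 1ℤ * g
          identity = solve-∀
  at₁ : (G (x + + 1) + G (x - + 1)) * + 1 ≡ G (x + + 1) - -1ℤ * G (x - + 1)
  at₁ = identity (G (x + + 1)) (G (x - + 1))
    where identity : ∀ a b → (a + b) * + 1 ≡ a - -1ℤ * b
          identity = solve-∀

L≡F+F : ∀ x → L x ≡ F (x + + 1) + F (x - + 1)
L≡F+F = FibRec-unique FibRec-L
                      (FibRec-+ (FibRec-shiftʳ FibRec-F (+ 1)) (FibRec-shiftʳ FibRec-F -1ℤ)) refl refl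

5F≡L+L : ∀ x → + 5 * F x ≡ L (x + + 1) + L (x - + 1)
5F≡L+L = FibRec-unique (FibRec-*ˡ FibRec-F (+ 5))
                       (FibRec-+ (FibRec-shiftʳ FibRec-L (+ 1)) (FibRec-shiftʳ FibRec-L -1ℤ)) refl refl

L*F : ∀ x y → L x * F y ≡ F (x + y) - neg1^ y * F (x - y)
L*F x y = trans (cong (_* F y) (L≡F+F x)) (mul-F FibRec-F x y)

F*F : ∀ x y → + 5 * F x * F y ≡ L (x + y) - neg1^ y * L (x - y)
F*F x y = trans (cong (_* F y) (5F≡L+L x)) (mul-F FibRec-L x y)

-- Triple products

F*F*F : ∀ a b c → + 5 * (F a * F b * F c) ≡ F (a + b + c) - neg1^ a * F (b + c - a) - neg1^ c * L (b - c) * F a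
F*F*F a b c = begin
  + 5 * (F a * F b * F c)                                         ≡⟨ regroup (F a) (F b) (F c) ⟩
  F a * (+ 5 * F b * F c)                                         ≡⟨ cong (F a *_) (F*F b c) ⟩
  F a * (L (b + c) - neg1^ c * L (b - c))                         ≡⟨ expand (F a) (L (b + c)) (neg1^ c) (L (b - c)) ⟩
  F a * L (b + c) - neg1^ c * L (b - c) * F a
    ≡⟨ cong (_- neg1^ c * L (b - c) * F a) (mul-L FibRec-F a (b + c)) ⟩
  F (a + (b + c)) + neg1^ (b + c) * F (a - (b + c)) - neg1^ c * L (b - c) * F a
    ≡⟨ cong (λ z → z - neg1^ c * L (b - c) * F a)
            (cong₂ _+_ (cong F (sym (+-assoc a b c))) (F-reflect (b + c) a)) ⟩
  F (a + b + c) - neg1^ a * F (b + c - a) - neg1^ c * L (b - c) * F a ∎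
  where
  regroup : ∀ x y z → + 5 * (x * y * z) ≡ x * (+ 5 * y * z)
  regroup = solve-∀
  expand : ∀ x p e q → x * (p - e * q) ≡ x * p - e * q * x
  expand = solve-∀

L*F*F : ∀ a b c → + 5 * (L a * F b * F c) ≡ L (a + b + c) + neg1^ a * L (b + c - a) - neg1^ c * L (b - c) * L a
L*F*F a b c = begin
  + 5 * (L a * F b * F c)                                         ≡⟨ regroup (L a) (F b) (F c) ⟩
  L a * (+ 5 * F b * F c)                                         ≡⟨ cong (L a *_) (F*F b c) ⟩
  L a * (L (b + c) - neg1^ c * L (b - c))                         ≡⟨ expand (L a) (L (b + c)) (neg1^ c) (L (b - c)) ⟩
  L a * L (b + c) - neg1^ c * L (b - c) * L a
    ≡⟨ cong (_- neg1^ c * L (b - c) * L a) (mul-L FibRec-L a (b + c)) ⟩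
  L (a + (b + c)) + neg1^ (b + c) * L (a - (b + c)) - neg1^ c * L (b - c) * L a
    ≡⟨ cong (λ z → z - neg1^ c * L (b - c) * L a)
            (cong₂ _+_ (cong L (sym (+-assoc a b c))) (L-reflect (b + c) a)) ⟩
  L (a + b + c) + neg1^ a * L (b + c - a) - neg1^ c * L (b - c) * L a ∎
  where
  regroup : ∀ x y z → + 5 * (x * y * z) ≡ x * (+ 5 * y * z)
  regroup = solve-∀
  expand : ∀ x p e q → x * (p - e * q) ≡ x * p - e * q * x
  expand = solve-∀

L*L*F : ∀ a b c → L a * L b * F c ≡ F (a + b + c) + neg1^ a * F (b + c - a) - neg1^ c * F (b - c) * L a
L*L*F a b c = begin
  L a * L b * F c                                                 ≡⟨ regroup (L a) (L b) (F c) ⟩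
  L a * (F c * L b)                                               ≡⟨ cong (L a *_) F*L ⟩
  L a * (F (b + c) - neg1^ c * F (b - c))                         ≡⟨ expand (L a) (F (b + c)) (neg1^ c) (F (b - c)) ⟩
  L a * F (b + c) - neg1^ c * F (b - c) * L a
    ≡⟨ cong (_- neg1^ c * F (b - c) * L a) (L*F a (b + c)) ⟩
  F (a + (b + c)) - neg1^ (b + c) * F (a - (b + c)) - neg1^ c * F (b - c) * L a
    ≡⟨ cong (λ z → z - neg1^ c * F (b - c) * L a)
            (cong₂ _-_ (cong F (sym (+-assoc a b c))) (F-reflect (b + c) a)) ⟩
  F (a + b + c) - - (neg1^ a * F (b + c - a)) - neg1^ c * F (b - c) * L a
    ≡⟨ cong (λ z → F (a + b + c) + z - neg1^ c * F (b - c) * L a) (neg-involutive (neg1^ a * F (b + c - a))) ⟩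
  F (a + b + c) + neg1^ a * F (b + c - a) - neg1^ c * F (b - c) * L a ∎
  where
  regroup : ∀ x y z → x * y * z ≡ x * (z * y)
  regroup = solve-∀
  expand : ∀ x p e q → x * (p - e * q) ≡ x * p - e * q * x
  expand = solve-∀
  F*L : F c * L b ≡ F (b + c) - neg1^ c * F (b - c)
  F*L = trans (mul-L FibRec-F c b) (cong₂ _+_ (cong F (+-comm c b)) (F-reflect b c))

L*L*L : ∀ a b c → L a * L b * L c ≡ L (a + b + c) + neg1^ a * L (b + c - a) + neg1^ c * L (b - c) * L a
L*L*L a b c = begin
  L a * L b * L c                                                 ≡⟨ *-assoc (L a) (L b) (L c) ⟩
  L a * (L b * L c)                                               ≡⟨ cong (L a *_) (mul-L FibRec-L b c) ⟩
  L a * (L (b + c) + neg1^ c * L (b - c))                         ≡⟨ expand (L a) (L (b + c)) (neg1^ c) (L (b - c)) ⟩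
  L a * L (b + c) + neg1^ c * L (b - c) * L a
    ≡⟨ cong (_+ neg1^ c * L (b - c) * L a) (mul-L FibRec-L a (b + c)) ⟩
  L (a + (b + c)) + neg1^ (b + c) * L (a - (b + c)) + neg1^ c * L (b - c) * L a
    ≡⟨ cong (λ z → z + neg1^ c * L (b - c) * L a)
            (cong₂ _+_ (cong L (sym (+-assoc a b c))) (L-reflect (b + c) a)) ⟩
  L (a + b + c) + neg1^ a * L (b + c - a) + neg1^ c * L (b - c) * L a ∎
  where
  expand : ∀ x p e q → x * (p + e * q) ≡ x * p + e * q * x
  expand = solve-∀

-- Finite sums

sumTo-cong : ∀ m {f g : ℕ → ℤ} → (∀ k → f k ≡ g k) → sumTo m f ≡ sumTo m g
sumTo-cong zero    f≡g = f≡g 0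
sumTo-cong (suc m) f≡g = cong₂ _+_ (sumTo-cong m f≡g) (f≡g (suc m))

sumTo-+ : ∀ m (f g : ℕ → ℤ) → sumTo m (λ k → f k + g k) ≡ sumTo m f + sumTo m g
sumTo-+ zero    f g = refl
sumTo-+ (suc m) f g = trans (cong (_+ (f (suc m) + g (suc m))) (sumTo-+ m f g))
                            (interchange (sumTo m f) (sumTo m g) (f (suc m)) (g (suc m)))

sumTo-*ˡ : ∀ m a (f : ℕ → ℤ) → sumTo m (λ k → a * f k) ≡ a * sumTo m f
sumTo-*ˡ zero    a f = refl
sumTo-*ˡ (suc m) a f = trans (cong (_+ a * f (suc m)) (sumTo-*ˡ m a f)) (sym (*-distribˡ-+ a _ _))

sumTo-zero : ∀ m {f : ℕ → ℤ} → (∀ k → f k ≡ 0ℤ) → sumTo m f ≡ 0ℤ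
sumTo-zero zero    f≡0 = f≡0 0
sumTo-zero (suc m) f≡0 = cong₂ _+_ (sumTo-zero m f≡0) (f≡0 (suc m))

sumTo-head : ∀ m (f : ℕ → ℤ) → sumTo (suc m) f ≡ f 0 + sumTo m (λ k → f (suc k))
sumTo-head zero    f = refl
sumTo-head (suc m) f = trans (cong (_+ f (suc (suc m))) (sumTo-head m f)) (+-assoc (f 0) _ _)

sumTo-pad : ∀ {m m′} (f : ℕ → ℤ) → (∀ k → m < k → f k ≡ 0ℤ) → m ≤′ m′ → sumTo m′ f ≡ sumTo m f
sumTo-pad f vanish (≤′-reflexive refl) = refl
sumTo-pad f vanish (≤′-step m≤′m′)    =
  trans (cong₂ _+_ (sumTo-pad f vanish m≤′m′) (vanish _ (s≤s (ℕₚ.≤′⇒≤ m≤′m′)))) (+-identityʳ _)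

sumTo-parity : ∀ m (f : ℕ → ℤ) →
  sumTo (suc (2 ℕ.* m)) f ≡ sumTo m (λ k → f (2 ℕ.* k)) + sumTo m (λ k → f (suc (2 ℕ.* k)))
sumTo-parity zero    f = refl
sumTo-parity (suc m) f = begin
  sumTo (suc (2 ℕ.* suc m)) f                         ≡⟨ cong (λ i → sumTo (suc i) f) (ℕₚ.*-suc 2 m) ⟩
  sumTo (suc (2 ℕ.* m)) f + f (2 ℕ.+ 2 ℕ.* m) + f (3 ℕ.+ 2 ℕ.* m)
    ≡⟨ cong (λ z → z + f (2 ℕ.+ 2 ℕ.* m) + f (3 ℕ.+ 2 ℕ.* m)) (sumTo-parity m f) ⟩
  E + O + f (2 ℕ.+ 2 ℕ.* m) + f (3 ℕ.+ 2 ℕ.* m)       ≡⟨ regroup E O _ _ ⟩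
  E + f (2 ℕ.+ 2 ℕ.* m) + (O + f (3 ℕ.+ 2 ℕ.* m))
    ≡⟨ cong (λ i → E + f i + (O + f (suc i))) (ℕₚ.*-suc 2 m) ⟨
  E + f (2 ℕ.* suc m) + (O + f (suc (2 ℕ.* suc m)))   ∎
  where
  E = sumTo m (λ k → f (2 ℕ.* k))
  O = sumTo m (λ k → f (suc (2 ℕ.* k)))
  regroup : ∀ e o x y → e + o + x + y ≡ e + x + (o + y)
  regroup = solve-∀

sumTo-weighted-cong : ∀ m (w : ℕ → ℤ) {f g : ℕ → ℤ} → (∀ k → f k ≡ g k) →
  sumTo m (λ k → w k * f k) ≡ sumTo m (λ k → w k * g k)
sumTo-weighted-cong m w f≡g = sumTo-cong m (λ k → cong (w k *_) (f≡g k))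

sumTo-weighted-+ : ∀ m (w f g : ℕ → ℤ) →
  sumTo m (λ k → w k * (f k + g k)) ≡ sumTo m (λ k → w k * f k) + sumTo m (λ k → w k * g k)
sumTo-weighted-+ m w f g = trans (sumTo-cong m (λ k → *-distribˡ-+ (w k) (f k) (g k))) (sumTo-+ m _ _)

sumTo-weighted-* : ∀ m (w : ℕ → ℤ) a (f : ℕ → ℤ) →
  sumTo m (λ k → w k * (a * f k)) ≡ a * sumTo m (λ k → w k * f k)
sumTo-weighted-* m w a f = trans (sumTo-cong m (λ k → x∙yz≈y∙xz (w k) a (f k))) (sumTo-*ˡ m a _)

-- Binomial sums

binomialSum : ℕ → (ℕ → ℤ) → ℤ
binomialSum n f = sumTo n (λ i → + (n C i) * f i)

binomialSum-cong : ∀ n {f g : ℕ → ℤ} → (∀ i → f i ≡ g i) → binomialSum n f ≡ binomialSum n g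
binomialSum-cong n = sumTo-weighted-cong n (λ i → + (n C i))

binomialSum-+ : ∀ n (f g : ℕ → ℤ) → binomialSum n (λ i → f i + g i) ≡ binomialSum n f + binomialSum n g
binomialSum-+ n = sumTo-weighted-+ n (λ i → + (n C i))

binomialSum-* : ∀ n a (f : ℕ → ℤ) → binomialSum n (λ i → a * f i) ≡ a * binomialSum n f
binomialSum-* n = sumTo-weighted-* n (λ i → + (n C i))

binomialSum-pascal : ∀ n (f : ℕ → ℤ) →
  binomialSum (suc n) f ≡ binomialSum n f + binomialSum n (λ i → f (suc i))
binomialSum-pascal n f = begin
  binomialSum (suc n) f                                       ≡⟨ sumTo-head n _ ⟩
  + 1 * f 0 + sumTo n (λ i → + (suc n C suc i) * f (suc i))
    ≡⟨ cong (λ z → + 1 * f 0 + z) (trans (sumTo-cong n pascal) (sumTo-+ n _ tail)) ⟩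
  + 1 * f 0 + (binomialSum n (λ i → f (suc i)) + sumTo n tail)
    ≡⟨ regroup (+ 1 * f 0) (binomialSum n (λ i → f (suc i))) (sumTo n tail) ⟩
  + 1 * f 0 + sumTo n tail + binomialSum n (λ i → f (suc i))
    ≡⟨ cong (_+ binomialSum n (λ i → f (suc i))) (sym (sumTo-head n _)) ⟩
  sumTo (suc n) (λ i → + (n C i) * f i) + binomialSum n (λ i → f (suc i))
    ≡⟨ cong (_+ binomialSum n (λ i → f (suc i))) (sumTo-pad _ beyond (≤′-step (≤′-reflexive refl))) ⟩
  binomialSum n f + binomialSum n (λ i → f (suc i))           ∎
  where
  tail : ℕ → ℤ
  tail i = + (n C suc i) * f (suc i)
  pascal : ∀ i → + (suc n C suc i) * f (suc i) ≡ + (n C i) * f (suc i) + tail i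
  pascal i = trans (cong (λ c → + c * f (suc i)) (sym (nCk+nC[k+1]≡[n+1]C[k+1] n i)))
                   (*-distribʳ-+ (f (suc i)) (+ (n C i)) (+ (n C suc i)))
  beyond : ∀ i → n < i → + (n C i) * f i ≡ 0ℤ
  beyond i n<i = cong (λ c → + c * f i) (k>n⇒nCk≡0 n<i)
  regroup : ∀ a b c → a + (b + c) ≡ a + c + b
  regroup = solve-∀

binomialSum-transform : ∀ (G : ℤ → ℤ) (α β p q : ℤ) → (∀ x → α * G (p + x) + G x ≡ β * G (q + x)) →
  ∀ n c → binomialSum n (λ i → α ^ i * G (+ i * p + c)) ≡ β ^ n * G (+ n * q + c)
binomialSum-transform G α β p q relation zero    c = *-identityˡ _
binomialSum-transform G α β p q relation (suc n) c = begin
  binomialSum (suc n) h                                         ≡⟨ binomialSum-pascal n h ⟩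
  binomialSum n h + binomialSum n (λ i → h (suc i))             ≡⟨ binomialSum-+ n h (λ i → h (suc i)) ⟨
  binomialSum n (λ i → h i + h (suc i))                         ≡⟨ binomialSum-cong n consecutive ⟩
  binomialSum n (λ i → β * (α ^ i * G (+ i * p + (q + c))))     ≡⟨ binomialSum-* n β _ ⟩
  β * binomialSum n (λ i → α ^ i * G (+ i * p + (q + c)))
    ≡⟨ cong (β *_) (binomialSum-transform G α β p q relation n (q + c)) ⟩
  β * (β ^ n * G (+ n * q + (q + c)))                           ≡⟨ *-assoc β _ _ ⟨
  β ^ suc n * G (+ n * q + (q + c))
    ≡⟨ cong (λ z → β ^ suc n * G z) (index₁ (+ n) q c) ⟩
  β ^ suc n * G (+ suc n * q + c)                               ∎
  where
  h : ℕ → ℤ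
  h i = α ^ i * G (+ i * p + c)
  index₁ : ∀ i q c → i * q + (q + c) ≡ (+ 1 + i) * q + c
  index₁ = solve-∀
  index₂ : ∀ i p c → (+ 1 + i) * p + c ≡ p + (i * p + c)
  index₂ = solve-∀
  index₃ : ∀ i p q c → q + (i * p + c) ≡ i * p + (q + c)
  index₃ = solve-∀
  factor : ∀ u a g g′ → u * g + a * u * g′ ≡ u * (a * g′ + g)
  factor = solve-∀
  consecutive : ∀ i → h i + h (suc i) ≡ β * (α ^ i * G (+ i * p + (q + c)))
  consecutive i = begin
    α ^ i * G x + α * α ^ i * G (+ suc i * p + c)
      ≡⟨ cong (λ z → α ^ i * G x + α * α ^ i * G z) (index₂ (+ i) p c) ⟩
    α ^ i * G x + α * α ^ i * G (p + x)             ≡⟨ factor (α ^ i) α (G x) (G (p + x)) ⟩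
    α ^ i * (α * G (p + x) + G x)                   ≡⟨ cong (α ^ i *_) (relation x) ⟩
    α ^ i * (β * G (q + x))                         ≡⟨ x∙yz≈y∙xz (α ^ i) β _ ⟩
    β * (α ^ i * G (q + x))                         ≡⟨ cong (λ z → β * (α ^ i * G z)) (index₃ (+ i) p q c) ⟩
    β * (α ^ i * G (+ i * p + (q + c)))             ∎
    where x = + i * p + c

n≤1+2⌊n/2⌋ : ∀ n → n ≤ suc (2 ℕ.* ℕ.⌊ n /2⌋)
n≤1+2⌊n/2⌋ zero          = z≤n
n≤1+2⌊n/2⌋ (suc zero)    = s≤s z≤n
n≤1+2⌊n/2⌋ (suc (suc n)) rewrite ℕₚ.*-suc 2 ℕ.⌊ n /2⌋ = s≤s (s≤s (n≤1+2⌊n/2⌋ n))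

-- The alternating sum cancels the odd terms and doubles the even ones.
binSum-even-part : ∀ n (g : ℤ → ℤ) →
  + 2 * binSum n g ≡ binomialSum n (λ i → g (+ i)) + binomialSum n (λ i → neg1^ (+ i) * g (+ i))
binSum-even-part n g = sym (begin
  binomialSum n (λ i → g (+ i)) + binomialSum n (λ i → neg1^ (+ i) * g (+ i))
    ≡⟨ binomialSum-+ n (λ i → g (+ i)) (λ i → neg1^ (+ i) * g (+ i)) ⟨
  sumTo n a                                          ≡⟨ sumTo-pad a beyond (ℕₚ.≤⇒≤′ (n≤1+2⌊n/2⌋ n)) ⟨
  sumTo (suc (2 ℕ.* h)) a                                      ≡⟨ sumTo-parity h a ⟩
  sumTo h (λ k → a (2 ℕ.* k)) + sumTo h (λ k → a (suc (2 ℕ.* k)))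
    ≡⟨ cong₂ _+_ (trans (sumTo-cong h even) (sumTo-*ˡ h (+ 2) _)) (sumTo-zero h odd) ⟩
  + 2 * binSum n g + 0ℤ                                        ≡⟨ +-identityʳ _ ⟩
  + 2 * binSum n g                                             ∎)
  where
  h = ℕ.⌊ n /2⌋
  a : ℕ → ℤ
  a i = + (n C i) * (g (+ i) + neg1^ (+ i) * g (+ i))
  beyond : ∀ i → n < i → a i ≡ 0ℤ
  beyond i n<i = cong (λ c → + c * (g (+ i) + neg1^ (+ i) * g (+ i))) (k>n⇒nCk≡0 n<i)
  doubled : ∀ c y → c * (y + 1ℤ * y) ≡ + 2 * (c * y)
  doubled = solve-∀
  cancelled : ∀ c y → c * (y + -1ℤ * 1ℤ * y) ≡ 0ℤ
  cancelled = solve-∀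
  even : ∀ k → a (2 ℕ.* k) ≡ + 2 * (+ (n C (2 ℕ.* k)) * g (+ (2 ℕ.* k)))
  even k = trans (cong (λ e → + (n C (2 ℕ.* k)) * (g (+ (2 ℕ.* k)) + e * g (+ (2 ℕ.* k)))) (neg1^-even k))
                 (doubled (+ (n C (2 ℕ.* k))) (g (+ (2 ℕ.* k))))
  odd : ∀ k → a (suc (2 ℕ.* k)) ≡ 0ℤ
  odd k = trans (cong (λ e → + (n C suc (2 ℕ.* k)) * (g (+ suc (2 ℕ.* k)) + -1ℤ * e * g (+ suc (2 ℕ.* k))))
                      (neg1^-even k))
                (cancelled (+ (n C suc (2 ℕ.* k))) (g (+ suc (2 ℕ.* k))))

pos-^ : ∀ m n → (+ m) ^ n ≡ + (m ℕ.^ n)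
pos-^ m zero    = refl
pos-^ m (suc n) = trans (cong (+ m *_) (pos-^ m n)) (sym (pos-* m (m ℕ.^ n)))

^-distrib-* : ∀ i j n → (i * j) ^ n ≡ i ^ n * j ^ n
^-distrib-* i j zero    = refl
^-distrib-* i j (suc n) = trans (cong (i * j *_) (^-distrib-* i j n)) (interleave i j (i ^ n) (j ^ n))
  where interleave : ∀ i j a b → i * j * (a * b) ≡ i * a * (j * b)
        interleave = solve-∀

1^i* : ∀ i x → 1ℤ ^ i * x ≡ x
1^i* i x = trans (cong (_* x) (^-zeroˡ i)) (*-identityˡ x)

module _ {G : ℤ → ℤ} (rG : FibRec G) where

  binSum-G[j+c] : ∀ n c → + 2 * binSum n (λ j → G (j + c)) ≡ G (+ 2 * + n + c) + neg1^ (+ n) * G (c - + n)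
  binSum-G[j+c] n c = trans (binSum-even-part n (λ j → G (j + c))) (cong₂ _+_ plain alternating)
    where
    step₊ : ∀ x → 1ℤ * G (+ 1 + x) + G x ≡ 1ℤ * G (+ 2 + x)
    step₊ x = trans (cong (_+ G x) (*-identityˡ (G (+ 1 + x))))
                    (sym (trans (*-identityˡ (G (+ 2 + x))) (recurrence rG x)))
    step₋ : ∀ x → -1ℤ * G (+ 1 + x) + G x ≡ -1ℤ * G (-1ℤ + x)
    step₋ x = trans (cong (λ z → -1ℤ * z + G x) (recurrence-at rG (index₁ x) (index₂ x)))
                    (cancel (G x) (G (-1ℤ + x)))
      where index₁ : ∀ x → x ≡ + 1 + (-1ℤ + x)
            index₁ = solve-∀
            index₂ : ∀ x → + 1 + x ≡ + 2 + (-1ℤ + x)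
            index₂ = solve-∀
            cancel : ∀ g h → -1ℤ * (g + h) + g ≡ -1ℤ * h
            cancel = solve-∀
    plain : binomialSum n (λ i → G (+ i + c)) ≡ G (+ 2 * + n + c)
    plain = begin
      binomialSum n (λ i → G (+ i + c))
        ≡⟨ binomialSum-cong n (λ i → sym (trans (1^i* i _) (cong (λ z → G (z + c)) (*-identityʳ (+ i))))) ⟩
      binomialSum n (λ i → 1ℤ ^ i * G (+ i * + 1 + c))
        ≡⟨ binomialSum-transform G 1ℤ 1ℤ (+ 1) (+ 2) step₊ n c ⟩
      1ℤ ^ n * G (+ n * + 2 + c)                          ≡⟨ 1^i* n _ ⟩
      G (+ n * + 2 + c)                                   ≡⟨ cong (λ z → G (z + c)) (*-comm (+ n) (+ 2)) ⟩
      G (+ 2 * + n + c)                                   ∎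
    alternating : binomialSum n (λ i → neg1^ (+ i) * G (+ i + c)) ≡ neg1^ (+ n) * G (c - + n)
    alternating = begin
      binomialSum n (λ i → neg1^ (+ i) * G (+ i + c))
        ≡⟨ binomialSum-cong n (λ i → cong (λ z → neg1^ (+ i) * G (z + c)) (sym (*-identityʳ (+ i)))) ⟩
      binomialSum n (λ i → -1ℤ ^ i * G (+ i * + 1 + c))
        ≡⟨ binomialSum-transform G -1ℤ -1ℤ (+ 1) -1ℤ step₋ n c ⟩
      -1ℤ ^ n * G (+ n * -1ℤ + c)                         ≡⟨ cong (λ z → -1ℤ ^ n * G z) (index (+ n) c) ⟩
      neg1^ (+ n) * G (c - + n)                           ∎
      where index : ∀ m c → m * -1ℤ + c ≡ c - m
            index = solve-∀

  binSum-G[3j+c] : ∀ n c → + 2 * binSum n (λ j → G (+ 3 * j + c))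
                           ≡ + (2 ℕ.^ n) * (G (+ 2 * + n + c) + neg1^ (+ n) * G (+ n + c))
  binSum-G[3j+c] n c = begin
    + 2 * binSum n (λ j → G (+ 3 * j + c))
      ≡⟨ binSum-even-part n (λ j → G (+ 3 * j + c)) ⟩
    binomialSum n (λ i → G (+ 3 * + i + c)) + binomialSum n (λ i → neg1^ (+ i) * G (+ 3 * + i + c))
      ≡⟨ cong₂ _+_ plain alternating ⟩
    + (2 ℕ.^ n) * G (+ 2 * + n + c) + neg1^ (+ n) * + (2 ℕ.^ n) * G (+ n + c)
      ≡⟨ collect (+ (2 ℕ.^ n)) (G (+ 2 * + n + c)) (neg1^ (+ n)) (G (+ n + c)) ⟩
    + (2 ℕ.^ n) * (G (+ 2 * + n + c) + neg1^ (+ n) * G (+ n + c))           ∎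
    where
    three : ∀ x → G (+ 3 + x) ≡ G (+ 1 + x) + G x + G (+ 1 + x)
    three x = trans (recurrence-at rG (index₁ x) (index₂ x)) (cong (_+ G (+ 1 + x)) (recurrence rG x))
      where index₁ : ∀ x → + 2 + x ≡ + 1 + (+ 1 + x)
            index₁ = solve-∀
            index₂ : ∀ x → + 3 + x ≡ + 2 + (+ 1 + x)
            index₂ = solve-∀
    step₊ : ∀ x → 1ℤ * G (+ 3 + x) + G x ≡ + 2 * G (+ 2 + x)
    step₊ x = begin
      1ℤ * G (+ 3 + x) + G x                               ≡⟨ cong (λ z → 1ℤ * z + G x) (three x) ⟩
      1ℤ * (G (+ 1 + x) + G x + G (+ 1 + x)) + G x         ≡⟨ double (G (+ 1 + x)) (G x) ⟩
      + 2 * (G (+ 1 + x) + G x)                            ≡⟨ cong (+ 2 *_) (recurrence rG x) ⟨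
      + 2 * G (+ 2 + x)                                    ∎
      where double : ∀ a b → 1ℤ * (a + b + a) + b ≡ + 2 * (a + b)
            double = solve-∀
    step₋ : ∀ x → -1ℤ * G (+ 3 + x) + G x ≡ -[1+ 1 ] * G (+ 1 + x)
    step₋ x = trans (cong (λ z → -1ℤ * z + G x) (three x)) (cancel (G (+ 1 + x)) (G x))
      where cancel : ∀ a b → -1ℤ * (a + b + a) + b ≡ -[1+ 1 ] * a
            cancel = solve-∀
    plain : binomialSum n (λ i → G (+ 3 * + i + c)) ≡ + (2 ℕ.^ n) * G (+ 2 * + n + c)
    plain = begin
      binomialSum n (λ i → G (+ 3 * + i + c))
        ≡⟨ binomialSum-cong n (λ i → sym (trans (1^i* i _) (cong (λ z → G (z + c)) (*-comm (+ i) (+ 3))))) ⟩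
      binomialSum n (λ i → 1ℤ ^ i * G (+ i * + 3 + c))
        ≡⟨ binomialSum-transform G 1ℤ (+ 2) (+ 3) (+ 2) step₊ n c ⟩
      (+ 2) ^ n * G (+ n * + 2 + c)
        ≡⟨ cong₂ (λ u z → u * G (z + c)) (pos-^ 2 n) (*-comm (+ n) (+ 2)) ⟩
      + (2 ℕ.^ n) * G (+ 2 * + n + c)                     ∎
    alternating : binomialSum n (λ i → neg1^ (+ i) * G (+ 3 * + i + c)) ≡ neg1^ (+ n) * + (2 ℕ.^ n) * G (+ n + c)
    alternating = begin
      binomialSum n (λ i → neg1^ (+ i) * G (+ 3 * + i + c))
        ≡⟨ binomialSum-cong n (λ i → cong (λ z → neg1^ (+ i) * G (z + c)) (*-comm (+ 3) (+ i))) ⟩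
      binomialSum n (λ i → -1ℤ ^ i * G (+ i * + 3 + c))
        ≡⟨ binomialSum-transform G -1ℤ -[1+ 1 ] (+ 3) (+ 1) step₋ n c ⟩
      -[1+ 1 ] ^ n * G (+ n * + 1 + c)
        ≡⟨ cong₂ (λ u z → u * G (z + c)) (trans (^-distrib-* -1ℤ (+ 2) n) (cong (-1ℤ ^ n *_) (pos-^ 2 n)))
                                         (*-identityʳ (+ n)) ⟩
      neg1^ (+ n) * + (2 ℕ.^ n) * G (+ n + c)             ∎
    collect : ∀ t a e b → t * a + e * t * b ≡ t * (a + e * b)
    collect = solve-∀

binSum-F[j+c] : ∀ n c → + 2 * binSum n (λ j → F (j + c)) ≡ F (+ 2 * + n + c) - neg1^ c * F (+ n - c)
binSum-F[j+c] n c = trans (binSum-G[j+c] FibRec-F n c) (cong (λ z → F (+ 2 * + n + c) + z) (F-reflect (+ n) c))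

binSum-L[j+c] : ∀ n c → + 2 * binSum n (λ j → L (j + c)) ≡ L (+ 2 * + n + c) + neg1^ c * L (+ n - c)
binSum-L[j+c] n c = trans (binSum-G[j+c] FibRec-L n c) (cong (λ z → L (+ 2 * + n + c) + z) (L-reflect (+ n) c))

binSum-linear : ∀ n K (g u v w : ℤ → ℤ) (x y : ℤ) {U V W : ℤ} →
  (∀ j → neg1^ j ≡ 1ℤ → K * g j ≡ u j + x * v j + y * w j) →
  + 2 * binSum n u ≡ U → + 2 * binSum n v ≡ V → + 2 * binSum n w ≡ W →
  + 2 * K * binSum n g ≡ U + x * V + y * W
binSum-linear n K g u v w x y {U} {V} {W} pointwise ΣU ΣV ΣW = begin
  + 2 * K * binSum n g                                                 ≡⟨ *-assoc (+ 2) K _ ⟩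
  + 2 * (K * binSum n g)                          ≡⟨ cong (λ z → + 2 * z) (sumTo-weighted-* h c K (even g)) ⟨
  + 2 * binSum n (λ j → K * g j)
    ≡⟨ cong (λ z → + 2 * z) (sumTo-weighted-cong h c (λ k → pointwise _ (neg1^-even k))) ⟩
  + 2 * binSum n (λ j → u j + x * v j + y * w j)                       ≡⟨ cong (λ z → + 2 * z) split ⟩
  + 2 * (binSum n u + x * binSum n v + y * binSum n w)
    ≡⟨ distribute (binSum n u) x (binSum n v) y (binSum n w) ⟩
  + 2 * binSum n u + x * (+ 2 * binSum n v) + y * (+ 2 * binSum n w)
    ≡⟨ cong₂ _+_ (cong₂ (λ p q → p + x * q) ΣU ΣV) (cong (y *_) ΣW) ⟩
  U + x * V + y * W                                                    ∎
  where
  h = ℕ.⌊ n /2⌋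
  c : ℕ → ℤ
  c k = + (n C (2 ℕ.* k))
  even : (ℤ → ℤ) → ℕ → ℤ
  even f k = f (+ (2 ℕ.* k))
  split : binSum n (λ j → u j + x * v j + y * w j) ≡ binSum n u + x * binSum n v + y * binSum n w
  split = trans (sumTo-weighted-+ h c (λ k → even u k + x * even v k) (λ k → y * even w k))
                (cong₂ _+_ (trans (sumTo-weighted-+ h c (even u) (λ k → x * even v k))
                                  (cong (λ z → binSum n u + z) (sumTo-weighted-* h c x (even v))))
                           (sumTo-weighted-* h c y (even w)))
  distribute : ∀ a x b y c → + 2 * (a + x * b + y * c) ≡ + 2 * a + x * (+ 2 * b) + y * (+ 2 * c)
  distribute = solve-∀

module _ (r s t : ℤ) {j : ℤ} (ej : neg1^ j ≡ 1ℤ) where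

  private
    sum-index : ∀ j r s t → j + r + (j + s) + (j + t) ≡ + 3 * j + (s + r + t)
    sum-index = solve-∀
    reflected-index : ∀ j r s t → j + s + (j + t) - (j + r) ≡ j + (s + t - r)
    reflected-index = solve-∀
    difference-index : ∀ j s t → j + s - (j + t) ≡ s - t
    difference-index = solve-∀

  -- Φ abstracts a triple-product identity over its data a + b + c, (-1)^a, b + c - a, (-1)^c, b - c;
  -- at a = j + r, b = j + s, c = j + t the signs lose j because j is even.
  even-shift : (Φ : ℤ → ℤ → ℤ → ℤ → ℤ → ℤ) →
    Φ (j + r + (j + s) + (j + t)) (neg1^ (j + r)) (j + s + (j + t) - (j + r)) (neg1^ (j + t)) (j + s - (j + t))
    ≡ Φ (+ 3 * j + (s + r + t)) (neg1^ r) (j + (s + t - r)) (neg1^ t) (s - t)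
  even-shift Φ rewrite sum-index j r s t | reflected-index j r s t | difference-index j s t =
    cong₂ (λ e e′ → Φ (+ 3 * j + (s + r + t)) e (j + (s + t - r)) e′ (s - t))
          (neg1^-even-shift {j} ej r) (neg1^-even-shift {j} ej t)

minus-minus : ∀ a x b y c → a - x * b - y * c ≡ a + - x * b + - y * c
minus-minus a x b y c = cong₂ _+_ (cong (λ z → a + z) (neg-distribˡ-* x b)) (neg-distribˡ-* y c)

plus-minus : ∀ a x b y c → a + x * b - y * c ≡ a + x * b + - y * c
plus-minus a x b y c = cong (λ z → a + x * b + z) (neg-distribˡ-* y c)

module _ (n : ℕ) (r s t K : ℤ) (P : ℤ → ℤ → ℤ → ℤ) (A B C H : ℤ → ℤ) {U V W : ℤ}
         (ΣA : + 2 * binSum n (λ j → A (+ 3 * j + (s + r + t))) ≡ U)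
         (ΣB : + 2 * binSum n (λ j → B (j + (s + t - r))) ≡ V)
         (ΣC : + 2 * binSum n (λ j → C (j + r)) ≡ W) where

  private
    g u v w : ℤ → ℤ
    g j = P (j + r) (j + s) (j + t)
    u j = A (+ 3 * j + (s + r + t))
    v j = B (j + (s + t - r))
    w j = C (j + r)
    y = neg1^ t * H (s - t)

  binSum-triple₊₊ : (∀ a b c → K * P a b c
                       ≡ A (a + b + c) + neg1^ a * B (b + c - a) + neg1^ c * H (b - c) * C a) →
                    + 2 * K * binSum n g ≡ U + neg1^ r * V + y * W
  binSum-triple₊₊ triple = binSum-linear n K g u v w (neg1^ r) y pointwise ΣA ΣB ΣC
    where
    pointwise : ∀ j → neg1^ j ≡ 1ℤ → K * g j ≡ u j + neg1^ r * v j + y * w j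
    pointwise j ej = trans (triple (j + r) (j + s) (j + t))
      (even-shift r s t {j} ej (λ a e b e′ d → A a + e * B b + e′ * H d * C (j + r)))

  binSum-triple₊₋ : (∀ a b c → K * P a b c
                       ≡ A (a + b + c) + neg1^ a * B (b + c - a) - neg1^ c * H (b - c) * C a) →
                    + 2 * K * binSum n g ≡ U + neg1^ r * V - y * W
  binSum-triple₊₋ triple =
    trans (binSum-linear n K g u v w (neg1^ r) (- y) pointwise ΣA ΣB ΣC) (sym (plus-minus U (neg1^ r) V y W))
    where
    pointwise : ∀ j → neg1^ j ≡ 1ℤ → K * g j ≡ u j + neg1^ r * v j + - y * w j
    pointwise j ej = trans (triple (j + r) (j + s) (j + t))
      (trans (even-shift r s t {j} ej (λ a e b e′ d → A a + e * B b - e′ * H d * C (j + r)))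
             (plus-minus (u j) (neg1^ r) (v j) y (w j)))

  binSum-triple₋₋ : (∀ a b c → K * P a b c
                       ≡ A (a + b + c) - neg1^ a * B (b + c - a) - neg1^ c * H (b - c) * C a) →
                    + 2 * K * binSum n g ≡ U - neg1^ r * V - y * W
  binSum-triple₋₋ triple =
    trans (binSum-linear n K g u v w (- neg1^ r) (- y) pointwise ΣA ΣB ΣC) (sym (minus-minus U (neg1^ r) V y W))
    where
    pointwise : ∀ j → neg1^ j ≡ 1ℤ → K * g j ≡ u j + - neg1^ r * v j + - y * w j
    pointwise j ej = trans (triple (j + r) (j + s) (j + t))
      (trans (even-shift r s t {j} ej (λ a e b e′ d → A a - e * B b - e′ * H d * C (j + r)))
             (minus-minus (u j) (neg1^ r) (v j) y (w j)))

module _ (n : ℕ) (r s t : ℤ) where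

  private
    reassoc : ∀ x a b c → x + (a + b + c) ≡ x + a + b + c
    reassoc = solve-∀
    unfold : ∀ x a b c → x - (a + b - c) ≡ x - a - b + c
    unfold = solve-∀

  binSum-G[3j+s+r+t] : ∀ {G} → FibRec G → + 2 * binSum n (λ j → G (+ 3 * j + (s + r + t)))
                        ≡ + (2 ℕ.^ n) * (G (+ 2 * + n + s + r + t) + neg1^ (+ n) * G (+ n + s + r + t))
  binSum-G[3j+s+r+t] {G} rG = trans (binSum-G[3j+c] rG n (s + r + t))
    (cong₂ (λ p q → + (2 ℕ.^ n) * (G p + neg1^ (+ n) * G q)) (reassoc (+ 2 * + n) s r t) (reassoc (+ n) s r t))

  binSum-F[j+s+t-r] : + 2 * binSum n (λ j → F (j + (s + t - r)))
                       ≡ F (+ 2 * + n + s + t - r) - neg1^ (s + t - r) * F (+ n - s - t + r)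
  binSum-F[j+s+t-r] = trans (binSum-F[j+c] n (s + t - r))
    (cong₂ (λ p q → F p - neg1^ (s + t - r) * F q) (reassoc (+ 2 * + n) s t (- r)) (unfold (+ n) s t r))

  binSum-L[j+s+t-r] : + 2 * binSum n (λ j → L (j + (s + t - r)))
                       ≡ L (+ 2 * + n + s + t - r) + neg1^ (s + t - r) * L (+ n - s - t + r)
  binSum-L[j+s+t-r] = trans (binSum-L[j+c] n (s + t - r))
    (cong₂ (λ p q → L p + neg1^ (s + t - r) * L q) (reassoc (+ 2 * + n) s t (- r)) (unfold (+ n) s t r))

theorem31 : (n : ℕ) (r s t : ℤ) →
    let m = + n in
    ((+ 10) * binSum n (λ j → F (j + r) * F (j + s) * F (j + t))
    ≡ (+ (2 ℕ.^ n)) * (F ((+ 2) * m + s + r + t) + neg1^ m * F (m + s + r + t))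
    - neg1^ r * (F ((+ 2) * m + s + t - r) - neg1^ (s + t - r) * F (m - s - t + r))
    - neg1^ t * L (s - t) * (F ((+ 2) * m + r) - neg1^ r * F (m - r)))
    × ((+ 10) * binSum n (λ j → L (j + r) * F (j + s) * F (j + t))
    ≡ (+ (2 ℕ.^ n)) * (L ((+ 2) * m + s + r + t) + neg1^ m * L (m + s + r + t))
    + neg1^ r * (L ((+ 2) * m + s + t - r) + neg1^ (s + t - r) * L (m - s - t + r))
    - neg1^ t * L (s - t) * (L ((+ 2) * m + r) + neg1^ r * L (m - r)))
    × ((+ 2) * binSum n (λ j → L (j + r) * L (j + s) * F (j + t))
    ≡ (+ (2 ℕ.^ n)) * (F ((+ 2) * m + s + r + t) + neg1^ m * F (m + s + r + t))
    + neg1^ r * (F ((+ 2) * m + s + t - r) - neg1^ (s + t - r) * F (m - s - t + r))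
    - neg1^ t * F (s - t) * (L ((+ 2) * m + r) + neg1^ r * L (m - r)))
    × ((+ 2) * binSum n (λ j → L (j + r) * L (j + s) * L (j + t))
    ≡ (+ (2 ℕ.^ n)) * (L ((+ 2) * m + s + r + t) + neg1^ m * L (m + s + r + t))
    + neg1^ r * (L ((+ 2) * m + s + t - r) + neg1^ (s + t - r) * L (m - s - t + r))
    + neg1^ t * L (s - t) * (L ((+ 2) * m + r) + neg1^ r * L (m - r)))
theorem31 n r s t =
    binSum-triple₋₋ n r s t (+ 5) (λ a b c → F a * F b * F c) F F F L
      (binSum-G[3j+s+r+t] n r s t FibRec-F) (binSum-F[j+s+t-r] n r s t) (binSum-F[j+c] n r) F*F*F
  , binSum-triple₊₋ n r s t (+ 5) (λ a b c → L a * F b * F c) L L L L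
      (binSum-G[3j+s+r+t] n r s t FibRec-L) (binSum-L[j+s+t-r] n r s t) (binSum-L[j+c] n r) L*F*F
  , binSum-triple₊₋ n r s t (+ 1) (λ a b c → L a * L b * F c) F F L F
      (binSum-G[3j+s+r+t] n r s t FibRec-F) (binSum-F[j+s+t-r] n r s t) (binSum-L[j+c] n r)
      (λ a b c → trans (*-identityˡ (L a * L b * F c)) (L*L*F a b c))
  , binSum-triple₊₊ n r s t (+ 1) (λ a b c → L a * L b * L c) L L L L
      (binSum-G[3j+s+r+t] n r s t FibRec-L) (binSum-L[j+s+t-r] n r s t) (binSum-L[j+c] n r)
      (λ a b c → trans (*-identityˡ (L a * L b * L c)) (L*L*L a b c))
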